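{- For every weight function $(w,w_0)$, subterm penalty function $p$, quasi-precedence $\succsim$ and status $\sigma$, the order $\succ_{\mathrm{WPO}(\mathcal A_{\max})}$ is a reduction order.
   Context: Terms over a finite signature $\Sigma$ and variables $\mathcal V$. Weight function $(w,w_0)$: $w:\Sigma\to\mathbb N$, $w_0\in\mathbb N$, $w(c)\ge w_0$ for constants. Subterm penalty function: $p(f,i)\in\mathbb N$ for $f\in\Sigma_n$, $1\le i\le n$. $\mathcal A_{\max}$: carrier $\{a\in\mathbb N\mid a\ge w_0\}$, usual $\ge,>$, $f_{\mathcal A}(a_1..a_n)=\max(w(f),\max_i(p(f,i)+a_i))$; on terms $s\ge_{\mathcal A}t$ ($>_{\mathcal A}$) iff $\hat\alpha(s)\ge\hat\alpha(t)$ ($>$) for all assignments. Quasi-precedence: quasi-order $\succsim$ on $\Sigma$ with well-founded strict part $\succ$, equivalence $\sim$. Status $\sigma$: $f\in\Sigma_n\mapsto$ permutation $[i_1..i_n]$, $\sigma(f)(s_1..s_n)=[s_{i_1},..,s_{i_n}]$. Lex extension of strict $\succ$ (reflexive closure $\succeq$): $[s_1..s_n]\succ^{\mathrm{lex}}[t_1..t_m]$ iff there is $k<n$ with $s_i\succeq t_i$ ($i\le k$) and either $k=m$, or $k<m$ and $s_{k+1}\succ t_{k+1}$. WPO: no variable is greater than any term; $s=f(s_1..s_n)\succ_{\mathrm{WPO}(\mathcal A)}t$ iff (1) $s>_{\mathcal A}t$, or (2) $s\ge_{\mathcal A}t$ and either $s_i\succeq_{\mathrm{WPO}(\mathcal A)}t$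 for some $i$, or $t=g(t_1..t_m)$, $s\succ_{\mathrm{WPO}(\mathcal A)}t_j$ for all $j$, and $f\succ g$ or ($f\sim g$ and $\sigma(f)(\vec s)\succ^{\mathrm{lex}}_{\mathrm{WPO}(\mathcal A)}\sigma(g)(\vec t)$). A reduction order is a well-founded, monotonic and stable strict order on terms. -}

module Defs where

open import Data.Nat using (ℕ; zero; suc; _≤_; _<_; _⊔_; _+_)
open import Data.Fin using (Fin; zero; suc)
open import Data.Vec using (Vec; []; _∷_; lookup; _[_]≔_)
open import Data.List using (List; []; _∷_; map)
open import Data.List using () renaming (map to lmap)
open import Data.Fin.Permutation using (Permutation′; _⟨$⟩ʳ_)
open import Data.Product using (_×_)
open import Data.Sum using (_⊎_)
open import Relation.Nullary using (¬_)
open import Relation.Binary.PropositionalEquality using (_≡_)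
open import Relation.Binary.Construct.Closure.Reflexive using (ReflClosure)
open import Induction.WellFounded using (WellFounded)
open import Function using (flip)
import Data.List as L

module Terms {k : ℕ} (ar : Fin k → ℕ) (V : Set) where

  data Term : Set where
    var : V → Term
    fun : (f : Fin k) → Vec Term (ar f) → Term

  Subst : Set
  Subst = V → Term

  mutual
    _⟪_⟫ : Term → Subst → Term
    var x ⟪ θ ⟫ = θ x
    fun f ts ⟪ θ ⟫ = fun f (substs ts θ)

    substs : ∀ {n} → Vec Term n → Subst → Vec Term n
    substs [] θ = []
    substs (t ∷ ts) θ = (t ⟪ θ ⟫) ∷ substs ts θ

  record ReductionOrder (_≻_ : Term → Term → Set) : Set where
    field
      irreflexive : ∀ s → ¬ (s ≻ s)
      transitive  : ∀ {s t u} → s ≻ t → t ≻ u → s ≻ u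
      wellFounded : WellFounded (flip _≻_)
      monotonic   : ∀ f (ss : Vec Term (ar f)) (i : Fin (ar f)) {s t} →
                    s ≻ t → fun f (ss [ i ]≔ s) ≻ fun f (ss [ i ]≔ t)
      stable      : ∀ (θ : Subst) {s t} → s ≻ t → (s ⟪ θ ⟫) ≻ (t ⟪ θ ⟫)

-- Lexicographic extension of a strict relation on lists
-- [s₁..sₙ] ≻lex [t₁..tₘ] iff ∃ k < n with sᵢ ⪰ tᵢ (i ≤ k) and
-- either k = m, or k < m and s_{k+1} ≻ t_{k+1}.
-- (inductive rendering of that definition)

data Lex {A : Set} (_≻_ : A → A → Set) : List A → List A → Set where
  lex-longer : ∀ {s ss} → Lex _≻_ (s ∷ ss) []
  lex-strict : ∀ {s ss t ts} → s ≻ t → Lex _≻_ (s ∷ ss) (t ∷ ts)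
  lex-weak   : ∀ {s ss t ts} → ReflClosure _≻_ s t → Lex _≻_ ss ts →
               Lex _≻_ (s ∷ ss) (t ∷ ts)

StrictPart : {A : Set} → (A → A → Set) → A → A → Set
StrictPart _≿_ f g = (f ≿ g) × ¬ (g ≿ f)

EquivPart : {A : Set} → (A → A → Set) → A → A → Set
EquivPart _≿_ f g = (f ≿ g) × (g ≿ f)

module WPOmax {k : ℕ} (ar : Fin k → ℕ) (V : Set)
  (w : Fin k → ℕ) (w₀ : ℕ)
  (p : (f : Fin k) → Fin (ar f) → ℕ)
  (_≿_ : Fin k → Fin k → Set)
  (σ : (f : Fin k) → Permutation′ (ar f)) where

  open Terms ar V

  -- assignments into the carrier {a ∈ ℕ | a ≥ w₀}
  Assignment : Set
  Assignment = V → ℕ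

  Valid : Assignment → Set
  Valid α = ∀ x → w₀ ≤ α x

  mutual
    eval : Assignment → Term → ℕ
    eval α (var x) = α x
    eval α (fun f ts) = w f ⊔ evalArgs α (p f) ts

    -- maxᵢ (pen i + ⟦tᵢ⟧), with max of the empty family = 0
    evalArgs : ∀ {n} → Assignment → (Fin n → ℕ) → Vec Term n → ℕ
    evalArgs α pen [] = 0
    evalArgs α pen (t ∷ ts) = (pen zero + eval α t) ⊔ evalArgs α (λ i → pen (suc i)) ts

  _≥A_ : Term → Term → Set
  s ≥A t = ∀ (α : Assignment) → Valid α → eval α t ≤ eval α s

  _>A_ : Term → Term → Set
  s >A t = ∀ (α : Assignment) → Valid α → eval α t < eval α s

  _≻ₚ_ = StrictPart _≿_
  _∼ₚ_ = EquivPart _≿_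

  status : (f : Fin k) → Vec Term (ar f) → List Term
  status f ss = L.map (λ j → lookup ss (σ f ⟨$⟩ʳ j)) (L.allFin (ar f))

  data _≻W_ : Term → Term → Set where
    wpo1  : ∀ {f ss t} → fun f ss >A t → fun f ss ≻W t
    wpo2a : ∀ {f ss t} → fun f ss ≥A t → (i : Fin (ar f)) →
            ReflClosure _≻W_ (lookup ss i) t → fun f ss ≻W t
    wpo2b : ∀ {f ss g ts} → fun f ss ≥A fun g ts →
            (∀ j → fun f ss ≻W lookup ts j) → f ≻ₚ g → fun f ss ≻W fun g ts
    wpo2c : ∀ {f ss g ts} → fun f ss ≥A fun g ts →
            (∀ j → fun f ss ≻W lookup ts j) → f ∼ₚ g →
            Lex _≻W_ (status f ss) (status g ts) → fun f ss ≻W fun g ts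

module Submission where

open import Defs
open import Data.Nat using (ℕ; _≤_)
open import Data.Fin using (Fin)
open import Data.Fin.Permutation using (Permutation′)
open import Relation.Binary.PropositionalEquality using (_≡_)
open import Relation.Binary.Structures using (IsPreorder)
open import Induction.WellFounded using (WellFounded)
open import Function using (flip)

open import Data.Nat using (zero; suc; _<_; _⊔_; _+_; z≤n; s≤s)
open import Data.Nat.Properties
  using (≤-refl; ≤-trans; <⇒≤; ≤-<-trans; <-≤-trans; m≤n+m; m≤m⊔n; m≤n⊔m;
         +-monoʳ-≤; ⊔-mono-≤; ⊔-monoʳ-≤)
open import Data.Fin using (zero; suc; _≟_)
open import Data.Fin.Permutation using (_⟨$⟩ʳ_; _⟨$⟩ˡ_; inverseʳ)
open import Data.Vec using (Vec; []; _∷_; lookup; _[_]≔_)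
open import Data.Vec.Properties using (lookup∘update; lookup∘update′)
open import Data.List using (List; []; _∷_; length; map; allFin)
open import Data.List.Properties using (map-∘; map-cong; length-map; length-tabulate)
open import Data.List.Extrema.Nat using (max; xs≤max)
open import Data.List.Relation.Unary.All using (All; []; _∷_)
import Data.List.Relation.Unary.All as All
open import Data.List.Relation.Unary.All.Properties using (map⁺; tabulate⁺)
open import Data.List.Relation.Unary.Any using (Any; here; there)
import Data.List.Relation.Unary.Any as Any
open import Data.List.Membership.Propositional.Properties using (∈-allFin; ∈-map⁺)
open import Data.Product using (_×_; _,_)
open import Data.Sum using (_⊎_; inj₁; inj₂)
open import Relation.Nullary using (yes; no)
open import Relation.Binary.PropositionalEquality
  using (refl; sym; trans; cong; cong₂; subst; subst₂)
open import Relation.Binary.Construct.Closure.Reflexive using (ReflClosure; [_]; refl)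
open import Induction.WellFounded using (Acc; acc; acc-inverse; wf⇒asym)

-- A strict A_max-decrease lowers the value of a term under the constant assignment w₀,
-- and every other WPO step does not raise it; so well-foundedness goes by induction on
-- that value, then on the precedence of the root symbol, then on the lexicographic order
-- of the status lists. The last is well-founded on lists of accessible terms because
-- the finite signature bounds their length. Stability rests on the substitution lemma
-- ⟦t θ⟧α = ⟦t⟧(⟦θ⟧α), which needs ⟦θ x⟧α ≥ w₀; this is where w(c) ≥ w₀ for constants
-- enters.

module Precedence {A : Set} {_≿_ : A → A → Set} (≿-isPreorder : IsPreorder _≡_ _≿_) where

  private
    module ≿ = IsPreorder ≿-isPreorder

  ∼-refl : ∀ {f} → EquivPart _≿_ f f
  ∼-refl = ≿.refl , ≿.refl

  ∼-sym : ∀ {f g} → EquivPart _≿_ f g → EquivPart _≿_ g f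
  ∼-sym (f≿g , g≿f) = g≿f , f≿g

  ∼-trans : ∀ {f g h} → EquivPart _≿_ f g → EquivPart _≿_ g h → EquivPart _≿_ f h
  ∼-trans (f≿g , g≿f) (g≿h , h≿g) = ≿.trans f≿g g≿h , ≿.trans h≿g g≿f

  ≻-trans : ∀ {f g h} → StrictPart _≿_ f g → StrictPart _≿_ g h → StrictPart _≿_ f h
  ≻-trans (f≿g , g⋡f) (g≿h , h⋡g) = ≿.trans f≿g g≿h , λ h≿f → h⋡g (≿.trans h≿f f≿g)

  ≻-∼-trans : ∀ {f g h} → StrictPart _≿_ f g → EquivPart _≿_ g h → StrictPart _≿_ f h
  ≻-∼-trans (f≿g , g⋡f) (g≿h , h≿g) = ≿.trans f≿g g≿h , λ h≿f → g⋡f (≿.trans g≿h h≿f)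

  ∼-≻-trans : ∀ {f g h} → EquivPart _≿_ f g → StrictPart _≿_ g h → StrictPart _≿_ f h
  ∼-≻-trans (f≿g , g≿f) (g≿h , h⋡g) = ≿.trans f≿g g≿h , λ h≿f → h⋡g (≿.trans h≿f f≿g)

module _ {A : Set} {_≻_ : A → A → Set} where

  Lex-pointwise : ∀ {B : Set} {F G : B → A} js →
                  (∀ j → ReflClosure _≻_ (F j) (G j)) → Any (λ j → F j ≻ G j) js →
                  Lex _≻_ (map F js) (map G js)
  Lex-pointwise (j ∷ js) F⪰G (here Fj≻Gj) = lex-strict Fj≻Gj
  Lex-pointwise (j ∷ js) F⪰G (there any)  = lex-weak (F⪰G j) (Lex-pointwise js F⪰G any)

  BoundedLex : ℕ → List A → List A → Set
  BoundedLex m ys xs = Lex _≻_ xs ys × length ys ≤ m × All (Acc (flip _≻_)) ys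

  mutual
    BoundedLex-acc : ∀ {m} xs → length xs ≤ m → All (Acc (flip _≻_)) xs → Acc (BoundedLex m) xs
    BoundedLex-acc []       _         _           = acc λ { (() , _) }
    BoundedLex-acc (x ∷ xs) (s≤s len) (ax ∷ axs) = ∷-acc ax (BoundedLex-acc xs len axs)

    ∷-acc : ∀ {m x xs} → Acc (flip _≻_) x → Acc (BoundedLex m) xs →
            Acc (BoundedLex (suc m)) (x ∷ xs)
    ∷-acc ax axs = acc (∷-acc-step ax axs)

    ∷-acc-step : ∀ {m x xs} → Acc (flip _≻_) x → Acc (BoundedLex m) xs →
                 ∀ {ys} → BoundedLex (suc m) ys (x ∷ xs) → Acc (BoundedLex (suc m)) ys
    ∷-acc-step _ _ {[]} _ = BoundedLex-acc [] z≤n []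
    ∷-acc-step (acc x-rec) _ {y ∷ ys} (lex-strict x≻y , s≤s len , _ ∷ ays) =
      ∷-acc (x-rec x≻y) (BoundedLex-acc ys len ays)
    ∷-acc-step (acc x-rec) _ {y ∷ ys} (lex-weak [ x≻y ] _ , s≤s len , _ ∷ ays) =
      ∷-acc (x-rec x≻y) (BoundedLex-acc ys len ays)
    ∷-acc-step ax (acc xs-rec) {_ ∷ ys} (lex-weak refl xs>ys , s≤s len , _ ∷ ays) =
      ∷-acc ax (xs-rec (xs>ys , len , ays))

module WPOmaxProperties {k : ℕ} (ar : Fin k → ℕ) (V : Set)
    (w : Fin k → ℕ) (w₀ : ℕ) (p : (f : Fin k) → Fin (ar f) → ℕ)
    (_≿_ : Fin k → Fin k → Set) (σ : (f : Fin k) → Permutation′ (ar f)) where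

  open Terms ar V
  open WPOmax ar V w w₀ p _≿_ σ

  _⪰W_ : Term → Term → Set
  _⪰W_ = ReflClosure _≻W_

  evalArgs-≥ : ∀ α {n} (pen : Fin n → ℕ) (ts : Vec Term n) j →
               pen j + eval α (lookup ts j) ≤ evalArgs α pen ts
  evalArgs-≥ α pen (t ∷ ts) zero    = m≤m⊔n _ _
  evalArgs-≥ α pen (t ∷ ts) (suc j) = ≤-trans (evalArgs-≥ α (λ i → pen (suc i)) ts j) (m≤n⊔m _ _)

  evalArgs-update-mono : ∀ α {n} (pen : Fin n → ℕ) (ts : Vec Term n) i {s t} →
                         eval α t ≤ eval α s →
                         evalArgs α pen (ts [ i ]≔ t) ≤ evalArgs α pen (ts [ i ]≔ s)
  evalArgs-update-mono α pen (_ ∷ ts) zero    t≤s = ⊔-mono-≤ (+-monoʳ-≤ (pen zero) t≤s) ≤-refl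
  evalArgs-update-mono α pen (_ ∷ ts) (suc i) t≤s =
    ⊔-mono-≤ ≤-refl (evalArgs-update-mono α (λ j → pen (suc j)) ts i t≤s)

  mutual
    eval-⟪⟫ : ∀ α θ t → eval α (t ⟪ θ ⟫) ≡ eval (λ x → eval α (θ x)) t
    eval-⟪⟫ α θ (var x)    = refl
    eval-⟪⟫ α θ (fun f ts) = cong (w f ⊔_) (evalArgs-substs α θ (p f) ts)

    evalArgs-substs : ∀ α θ {n} (pen : Fin n → ℕ) (ts : Vec Term n) →
                      evalArgs α pen (substs ts θ) ≡ evalArgs (λ x → eval α (θ x)) pen ts
    evalArgs-substs α θ pen []       = refl
    evalArgs-substs α θ pen (t ∷ ts) =
      cong₂ (λ a b → (pen zero + a) ⊔ b) (eval-⟪⟫ α θ t) (evalArgs-substs α θ (λ i → pen (suc i)) ts)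

  fun-≥A-arg : ∀ f ss j → fun f ss ≥A lookup ss j
  fun-≥A-arg f ss j α _ = ≤-trans (m≤n+m _ (p f j)) (≤-trans (evalArgs-≥ α (p f) ss j) (m≤n⊔m _ _))

  ≥A-trans : ∀ s t u → s ≥A t → t ≥A u → s ≥A u
  ≥A-trans _ _ _ s≥t t≥u α v = ≤-trans (t≥u α v) (s≥t α v)

  ≥A->A-trans : ∀ s t u → s ≥A t → t >A u → s >A u
  ≥A->A-trans _ _ _ s≥t t>u α v = <-≤-trans (t>u α v) (s≥t α v)

  >A-≥A-trans : ∀ s t u → s >A t → t ≥A u → s >A u
  >A-≥A-trans _ _ _ s>t t≥u α v = ≤-<-trans (t≥u α v) (s>t α v)

  ≻W⇒≥A : ∀ {s t} → s ≻W t → s ≥A t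
  ≻W⇒≥A (wpo1 s>t) α v    = <⇒≤ (s>t α v)
  ≻W⇒≥A (wpo2a s≥t _ _)   = s≥t
  ≻W⇒≥A (wpo2b s≥t _ _)   = s≥t
  ≻W⇒≥A (wpo2c s≥t _ _ _) = s≥t

  ⪰W⇒≥A : ∀ {s t} → s ⪰W t → s ≥A t
  ⪰W⇒≥A [ s≻t ] = ≻W⇒≥A s≻t
  ⪰W⇒≥A refl α v = ≤-refl

  subterm-≻W : ∀ f ss j {u} → lookup ss j ⪰W u → fun f ss ≻W u
  subterm-≻W f ss j {u} ssⱼ⪰u =
    wpo2a (≥A-trans (fun f ss) (lookup ss j) u (fun-≥A-arg f ss j) (⪰W⇒≥A ssⱼ⪰u)) j ssⱼ⪰u

  data RootDecrease (f : Fin k) (ss : Vec Term (ar f)) (g : Fin k) (ts : Vec Term (ar g)) : Set where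
    by-precedence : f ≻ₚ g → RootDecrease f ss g ts
    by-status     : f ∼ₚ g → Lex _≻W_ (status f ss) (status g ts) → RootDecrease f ss g ts

  wpo2-root : ∀ {f ss g ts} → fun f ss ≥A fun g ts → (∀ j → fun f ss ≻W lookup ts j) →
              RootDecrease f ss g ts → fun f ss ≻W fun g ts
  wpo2-root s≥t args (by-precedence f≻g) = wpo2b s≥t args f≻g
  wpo2-root s≥t args (by-status f∼g lx)  = wpo2c s≥t args f∼g lx

  -- Stability

  module _ (w-nullary : ∀ c → ar c ≡ 0 → w₀ ≤ w c) where

    mutual
      eval-≥-w₀ : ∀ α → Valid α → ∀ t → w₀ ≤ eval α t
      eval-≥-w₀ α v (var x) = v x
      eval-≥-w₀ α v (fun f ts) with evalArgs-≥-w₀ α v (p f) ts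
      ... | inj₁ nullary = ≤-trans (w-nullary f nullary) (m≤m⊔n _ _)
      ... | inj₂ w₀≤args = ≤-trans w₀≤args (m≤n⊔m _ _)

      evalArgs-≥-w₀ : ∀ α → Valid α → ∀ {n} (pen : Fin n → ℕ) (ts : Vec Term n) →
                      n ≡ 0 ⊎ w₀ ≤ evalArgs α pen ts
      evalArgs-≥-w₀ α v pen []       = inj₁ refl
      evalArgs-≥-w₀ α v pen (t ∷ ts) =
        inj₂ (≤-trans (eval-≥-w₀ α v t) (≤-trans (m≤n+m _ (pen zero)) (m≤m⊔n _ _)))

    ≥A-stable : ∀ θ s t → s ≥A t → (s ⟪ θ ⟫) ≥A (t ⟪ θ ⟫)
    ≥A-stable θ s t s≥t α v =
      subst₂ _≤_ (sym (eval-⟪⟫ α θ t)) (sym (eval-⟪⟫ α θ s))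
        (s≥t _ (λ x → eval-≥-w₀ α v (θ x)))

    >A-stable : ∀ θ s t → s >A t → (s ⟪ θ ⟫) >A (t ⟪ θ ⟫)
    >A-stable θ s t s>t α v =
      subst₂ _<_ (sym (eval-⟪⟫ α θ t)) (sym (eval-⟪⟫ α θ s))
        (s>t _ (λ x → eval-≥-w₀ α v (θ x)))

    lookup-substs : ∀ θ {n} (ts : Vec Term n) i → lookup (substs ts θ) i ≡ lookup ts i ⟪ θ ⟫
    lookup-substs θ (t ∷ ts) zero    = refl
    lookup-substs θ (t ∷ ts) (suc i) = lookup-substs θ ts i

    status-substs : ∀ θ f ss → status f (substs ss θ) ≡ map (_⟪ θ ⟫) (status f ss)
    status-substs θ f ss =
      trans (map-cong (λ j → lookup-substs θ ss (σ f ⟨$⟩ʳ j)) (allFin (ar f))) (map-∘ (allFin (ar f)))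

    mutual
      ≻W-stable : ∀ θ {s t} → s ≻W t → (s ⟪ θ ⟫) ≻W (t ⟪ θ ⟫)
      ≻W-stable θ {s} {t} (wpo1 s>t) = wpo1 (>A-stable θ s t s>t)
      ≻W-stable θ {s} {t} (wpo2a {ss = ss} s≥t i ssᵢ⪰t) =
        wpo2a (≥A-stable θ s t s≥t) i
          (subst (_⪰W (t ⟪ θ ⟫)) (sym (lookup-substs θ ss i)) (⪰W-stable θ ssᵢ⪰t))
      ≻W-stable θ {s} {t} (wpo2b {ts = ts} s≥t args f≻g) =
        wpo2b (≥A-stable θ s t s≥t) (args-stable θ ts args) f≻g
      ≻W-stable θ {s} {t} (wpo2c {f} {ss} {g} {ts} s≥t args f∼g lx) =
        wpo2c (≥A-stable θ s t s≥t) (args-stable θ ts args) f∼g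
          (subst₂ (Lex _≻W_) (sym (status-substs θ f ss)) (sym (status-substs θ g ts))
            (Lex-stable θ lx))

      args-stable : ∀ θ {s n} (ts : Vec Term n) → (∀ j → s ≻W lookup ts j) →
                    ∀ j → (s ⟪ θ ⟫) ≻W lookup (substs ts θ) j
      args-stable θ {s} ts args j =
        subst ((s ⟪ θ ⟫) ≻W_) (sym (lookup-substs θ ts j)) (≻W-stable θ (args j))

      ⪰W-stable : ∀ θ {s t} → s ⪰W t → (s ⟪ θ ⟫) ⪰W (t ⟪ θ ⟫)
      ⪰W-stable θ refl    = refl
      ⪰W-stable θ [ s≻t ] = [ ≻W-stable θ s≻t ]

      Lex-stable : ∀ θ {xs ys} → Lex _≻W_ xs ys → Lex _≻W_ (map (_⟪ θ ⟫) xs) (map (_⟪ θ ⟫) ys)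
      Lex-stable θ lex-longer        = lex-longer
      Lex-stable θ (lex-strict x≻y)  = lex-strict (≻W-stable θ x≻y)
      Lex-stable θ (lex-weak x⪰y lx) = lex-weak (⪰W-stable θ x⪰y) (Lex-stable θ lx)

  module _ (≿-isPreorder : IsPreorder _≡_ _≿_) where

    open Precedence ≿-isPreorder

    -- Transitivity

    RootDecrease-≻ₚ-trans : ∀ {f ss g ts h us} → RootDecrease f ss g ts → g ≻ₚ h →
                            RootDecrease f ss h us
    RootDecrease-≻ₚ-trans (by-precedence f≻g) g≻h = by-precedence (≻-trans f≻g g≻h)
    RootDecrease-≻ₚ-trans (by-status f∼g _)   g≻h = by-precedence (∼-≻-trans f∼g g≻h)

    mutual
      ≻W-trans : ∀ {s t u} → s ≻W t → t ≻W u → s ≻W u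
      ≻W-trans {s} {t} {u} (wpo1 s>t) t≻u = wpo1 (>A-≥A-trans s t u s>t (≻W⇒≥A t≻u))
      ≻W-trans (wpo2a {f} {ss} _ i refl)      t≻u = subterm-≻W f ss i [ t≻u ]
      ≻W-trans (wpo2a {f} {ss} _ i [ ssᵢ≻t ]) t≻u = subterm-≻W f ss i [ ≻W-trans ssᵢ≻t t≻u ]
      ≻W-trans (wpo2b s≥t args f≻g)    t≻u = RootDecrease-≻W-trans s≥t args (by-precedence f≻g) t≻u
      ≻W-trans (wpo2c s≥t args f∼g lx) t≻u = RootDecrease-≻W-trans s≥t args (by-status f∼g lx) t≻u

      RootDecrease-≻W-trans : ∀ {f ss g ts u} → fun f ss ≥A fun g ts →
                              (∀ j → fun f ss ≻W lookup ts j) → RootDecrease f ss g ts →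
                              fun g ts ≻W u → fun f ss ≻W u
      RootDecrease-≻W-trans {f} {ss} {g} {ts} {u} s≥t _ _ (wpo1 t>u) =
        wpo1 (≥A->A-trans (fun f ss) (fun g ts) u s≥t t>u)
      RootDecrease-≻W-trans _ args _ (wpo2a _ j refl)      = args j
      RootDecrease-≻W-trans _ args _ (wpo2a _ j [ tⱼ≻u ]) = ≻W-trans (args j) tⱼ≻u
      RootDecrease-≻W-trans {f} {ss} {g} {ts} s≥t args rd (wpo2b {g = h} {us} t≥u args′ g≻h) =
        wpo2-root (≥A-trans (fun f ss) (fun g ts) (fun h us) s≥t t≥u)
          (λ l → RootDecrease-≻W-trans s≥t args rd (args′ l))
          (RootDecrease-≻ₚ-trans rd g≻h)
      RootDecrease-≻W-trans {f} {ss} {g} {ts} s≥t args rd (wpo2c {g = h} {us} t≥u args′ g∼h lx′) =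
        wpo2-root (≥A-trans (fun f ss) (fun g ts) (fun h us) s≥t t≥u)
          (λ l → RootDecrease-≻W-trans s≥t args rd (args′ l))
          (RootDecrease-∼ₚ-trans rd g∼h lx′)

      RootDecrease-∼ₚ-trans : ∀ {f ss g ts h us} → RootDecrease f ss g ts → g ∼ₚ h →
                              Lex _≻W_ (status g ts) (status h us) → RootDecrease f ss h us
      RootDecrease-∼ₚ-trans (by-precedence f≻g) g∼h _   = by-precedence (≻-∼-trans f≻g g∼h)
      RootDecrease-∼ₚ-trans (by-status f∼g lx)  g∼h lx′ = by-status (∼-trans f∼g g∼h) (Lex-trans lx lx′)

      Lex-trans : ∀ {xs ys zs} → Lex _≻W_ xs ys → Lex _≻W_ ys zs → Lex _≻W_ xs zs
      Lex-trans lex-longer       ()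
      Lex-trans (lex-strict _)   lex-longer       = lex-longer
      Lex-trans (lex-weak _ _)   lex-longer       = lex-longer
      Lex-trans (lex-strict x≻y) (lex-strict y≻z) = lex-strict (≻W-trans x≻y y≻z)
      Lex-trans (lex-strict x≻y) (lex-weak y⪰z _) = lex-strict (≻W-⪰W-trans x≻y y⪰z)
      Lex-trans (lex-weak x⪰y _) (lex-strict y≻z) = lex-strict (⪰W-≻W-trans x⪰y y≻z)
      Lex-trans (lex-weak x⪰y lx) (lex-weak y⪰z lx′) = lex-weak (⪰W-trans x⪰y y⪰z) (Lex-trans lx lx′)

      ≻W-⪰W-trans : ∀ {s t u} → s ≻W t → t ⪰W u → s ≻W u
      ≻W-⪰W-trans s≻t refl    = s≻t
      ≻W-⪰W-trans s≻t [ t≻u ] = ≻W-trans s≻t t≻u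

      ⪰W-≻W-trans : ∀ {s t u} → s ⪰W t → t ≻W u → s ≻W u
      ⪰W-≻W-trans refl    t≻u = t≻u
      ⪰W-≻W-trans [ s≻t ] t≻u = ≻W-trans s≻t t≻u

      ⪰W-trans : ∀ {s t u} → s ⪰W t → t ⪰W u → s ⪰W u
      ⪰W-trans refl    t⪰u     = t⪰u
      ⪰W-trans [ s≻t ] t⪰u     = [ ≻W-⪰W-trans s≻t t⪰u ]

    -- Monotonicity

    ≻W-mono : ∀ f (ss : Vec Term (ar f)) (i : Fin (ar f)) {s t} →
              s ≻W t → fun f (ss [ i ]≔ s) ≻W fun f (ss [ i ]≔ t)
    ≻W-mono f ss i {s} {t} s≻t =
      wpo2c (λ α v → ⊔-monoʳ-≤ (w f) (evalArgs-update-mono α (p f) ss i (≻W⇒≥A s≻t α v)))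
        (λ j → subterm-≻W f (ss [ i ]≔ s) j (updated-⪰W j)) ∼-refl
        (Lex-pointwise (allFin (ar f)) (λ j → updated-⪰W (σ f ⟨$⟩ʳ j)) strict-at-i)
      where
      updated-≻W : ∀ m → m ≡ i → lookup (ss [ i ]≔ s) m ≻W lookup (ss [ i ]≔ t) m
      updated-≻W m refl = subst₂ _≻W_ (sym (lookup∘update m ss s)) (sym (lookup∘update m ss t)) s≻t

      updated-⪰W : ∀ m → lookup (ss [ i ]≔ s) m ⪰W lookup (ss [ i ]≔ t) m
      updated-⪰W m with m ≟ i
      ... | yes m≡i = [ updated-≻W m m≡i ]
      ... | no  m≢i = subst₂ _⪰W_ (sym (lookup∘update′ m≢i ss s)) (sym (lookup∘update′ m≢i ss t)) refl

      strict-at-i : Any (λ j → lookup (ss [ i ]≔ s) (σ f ⟨$⟩ʳ j) ≻W lookup (ss [ i ]≔ t) (σ f ⟨$⟩ʳ j))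
                        (allFin (ar f))
      strict-at-i = Any.map (λ i′≡j → updated-≻W _ (trans (cong (σ f ⟨$⟩ʳ_) (sym i′≡j)) (inverseʳ (σ f))))
                            (∈-allFin (σ f ⟨$⟩ˡ i))

    -- Well-foundedness

    module _ (≻ₚ-wellFounded : WellFounded (flip _≻ₚ_)) where

      AccW : Term → Set
      AccW = Acc (flip _≻W_)

      maxArity : ℕ
      maxArity = max 0 (map ar (allFin k))

      status-length : ∀ g ts → length (status g ts) ≤ maxArity
      status-length g ts
        rewrite length-map (λ j → lookup ts (σ g ⟨$⟩ʳ j)) (allFin (ar g))
              | length-tabulate {n = ar g} (λ j → j)
        = All.lookup (xs≤max 0 (map ar (allFin k))) (∈-map⁺ ar (∈-allFin g))

      status-All-acc : ∀ g ts → (∀ j → AccW (lookup ts j)) → All AccW (status g ts)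
      status-All-acc g ts accs = map⁺ (tabulate⁺ (λ j → accs (σ g ⟨$⟩ʳ j)))

      StatusAcc : (g : Fin k) → Vec Term (ar g) → Set
      StatusAcc g ts = Acc (BoundedLex {_≻_ = _≻W_} maxArity) (status g ts)

      status-lex-acc : ∀ g ts → (∀ j → AccW (lookup ts j)) → StatusAcc g ts
      status-lex-acc g ts accs = BoundedLex-acc _ (status-length g ts) (status-All-acc g ts accs)

      weight : Term → ℕ
      weight = eval (λ _ → w₀)

      weight-valid : Valid (λ _ → w₀)
      weight-valid _ = ≤-refl

      module BelowWeight (n : ℕ) (lighter-acc : ∀ t → weight t < n → AccW t) where

        -- The precedence induction runs on a fixed representative f of the ∼-class of the
        -- root g, since a lexicographic step may change the root within that class.
        mutual
          fun-acc : ∀ {f} → Acc (flip _≻ₚ_) f → ∀ {g} → g ∼ₚ f → ∀ {ts} →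
                    weight (fun g ts) ≤ n → (∀ j → AccW (lookup ts j)) → StatusAcc g ts →
                    AccW (fun g ts)
          fun-acc af g∼f le accs st = acc (reduct-acc af g∼f le accs st)

          reduct-acc : ∀ {f} → Acc (flip _≻ₚ_) f → ∀ {g} → g ∼ₚ f → ∀ {ts} →
                       weight (fun g ts) ≤ n → (∀ j → AccW (lookup ts j)) → StatusAcc g ts →
                       ∀ {u} → fun g ts ≻W u → AccW u
          reduct-acc _ _ le _ _ {u} (wpo1 s>u) = lighter-acc u (<-≤-trans (s>u _ weight-valid) le)
          reduct-acc _ _ _ accs _ (wpo2a _ i refl)      = accs i
          reduct-acc _ _ _ accs _ (wpo2a _ i [ tᵢ≻u ]) = acc-inverse (accs i) tᵢ≻u
          reduct-acc (acc f-rec) g∼f le accs st (wpo2b {g = h} {us} s≥u args g≻h) =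
            let us-acc = λ l → reduct-acc (acc f-rec) g∼f le accs st (args l) in
            fun-acc (f-rec (∼-≻-trans (∼-sym g∼f) g≻h)) ∼-refl (≤-trans (s≥u _ weight-valid) le)
              us-acc (status-lex-acc h us us-acc)
          reduct-acc af g∼f le accs (acc st-rec) (wpo2c {g = h} {us} s≥u args g∼h lx) =
            let us-acc = λ l → reduct-acc af g∼f le accs (acc st-rec) (args l) in
            fun-acc af (∼-trans (∼-sym g∼h) g∼f) (≤-trans (s≥u _ weight-valid) le)
              us-acc (st-rec (lx , status-length h us , status-All-acc h us us-acc))

      mutual
        term-acc : ∀ n → (∀ t → weight t < n → AccW t) → ∀ t → weight t ≤ n → AccW t
        term-acc n lighter-acc (var x)    _  = acc λ ()
        term-acc n lighter-acc (fun g ts) le =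
          BelowWeight.fun-acc n lighter-acc (≻ₚ-wellFounded g) ∼-refl le accs (status-lex-acc g ts accs)
          where
          accs : ∀ j → AccW (lookup ts j)
          accs = args-acc n lighter-acc ts (λ j → ≤-trans (fun-≥A-arg g ts j _ weight-valid) le)

        args-acc : ∀ n → (∀ t → weight t < n → AccW t) → ∀ {m} (ts : Vec Term m) →
                   (∀ j → weight (lookup ts j) ≤ n) → ∀ j → AccW (lookup ts j)
        args-acc n lighter-acc (t ∷ ts) le zero    = term-acc n lighter-acc t (le zero)
        args-acc n lighter-acc (t ∷ ts) le (suc j) = args-acc n lighter-acc ts (λ i → le (suc i)) j

      lighter-acc : ∀ n t → weight t < n → AccW t
      lighter-acc (suc n) t (s≤s le) = term-acc n (lighter-acc n) t le

      ≻W-wellFounded : WellFounded (flip _≻W_)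
      ≻W-wellFounded t = lighter-acc (suc (weight t)) t ≤-refl

  reductionOrder : (∀ c → ar c ≡ 0 → w₀ ≤ w c) → IsPreorder _≡_ _≿_ →
                   WellFounded (flip _≻ₚ_) → ReductionOrder _≻W_
  reductionOrder w-nullary ≿-isPreorder ≻ₚ-wellFounded = record
    { irreflexive = λ s s≻s → wf⇒asym wf s≻s s≻s
    ; transitive  = ≻W-trans ≿-isPreorder
    ; wellFounded = wf
    ; monotonic   = ≻W-mono ≿-isPreorder
    ; stable      = ≻W-stable w-nullary
    }
    where
    wf = ≻W-wellFounded ≿-isPreorder ≻ₚ-wellFounded

corollary3 : {k : ℕ} (ar : Fin k → ℕ) (V : Set)
    (w : Fin k → ℕ) (w₀ : ℕ) → (∀ c → ar c ≡ 0 → w₀ ≤ w c) →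
    (p : (f : Fin k) → Fin (ar f) → ℕ) →
    (_≿_ : Fin k → Fin k → Set) → IsPreorder _≡_ _≿_ →
    WellFounded (flip (StrictPart _≿_)) →
    (σ : (f : Fin k) → Permutation′ (ar f)) →
    Terms.ReductionOrder ar V (WPOmax._≻W_ ar V w w₀ p _≿_ σ)
corollary3 ar V w w₀ w-nullary p _≿_ ≿-isPreorder ≻ₚ-wellFounded σ =
  WPOmaxProperties.reductionOrder ar V w w₀ p _≿_ σ w-nullary ≿-isPreorder ≻ₚ-wellFounded
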